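{- Let $q$ be a power of a prime $p$, let $n \ge 2$, let $\zeta$ be a primitive element of $\mathbb{F}_{q^n}$ and let $w \in \{0,1,\dots,n\}$. If $q = 2$, further assume that $w \neq n$. Then $\sigma_w(\zeta^k) = \mathcal{F}_\zeta[\delta_w](k)$ for all $k \in \mathbb{Z}_{q^n-1}$.
   Context: $\sigma_0(x) = 1$ and for $1 \le w \le n$, $\sigma_w(x) = \sum_{0\le i_1<\cdots<i_w\le n-1} x^{q^{i_1}+\cdots+q^{i_w}} \in \mathbb{F}_q[x]$. Elements of $\mathbb{Z}_{q^n-1}$ are identified with their canonical representatives in $\{0,1,\dots,q^n-2\}$. $\Omega(0) = \{0\}$ and for $1\le w\le n$, $\Omega(w)$ is the set of $k\in\mathbb{Z}_{q^n-1}$ whose canonical representative equals $q^{i_1}+\cdots+q^{i_w}$ for some $0\le i_1<\cdots<i_w\le n-1$. $\delta_w : \mathbb{Z}_{q^n-1}\to\mathbb{F}_p$ is the indicator function of $\Omega(w)$ (value $1$ on $\Omega(w)$, $0$ elsewhere). The DFT is $\mathcal{F}_\zeta[f](k) = \sum_{j\in\mathbb{Z}_{q^n-1}} f(j)\zeta^{kj}$. -}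

module Defs where

open import Level using (Level; _⊔_)
open import Data.Nat as ℕ using (ℕ; zero; suc; _<_)
open import Data.Bool using (Bool; true; false; if_then_else_)
open import Data.List using (List; []; _∷_; map; _++_; foldr)
open import Data.Bool.ListAction using (any)
open import Relation.Binary.PropositionalEquality using (_≡_)
open import Data.Fin using (Fin)
open import Data.Product using (Σ; ∃; _×_; _,_)
open import Relation.Nullary using (¬_)
open import Relation.Nullary.Decidable using (⌊_⌋)
open import Algebra.Bundles using (CommutativeRing)

record IsField {c ℓ : Level} (R : CommutativeRing c ℓ) : Set (c ⊔ ℓ) where
  open CommutativeRing R
  field
    1≉0 : ¬ (1# ≈ 0#)
    inverse : ∀ x → ¬ (x ≈ 0#) → Σ Carrier λ y → (x * y) ≈ 1#

module _ {c ℓ : Level} (R : CommutativeRing c ℓ) where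
  open CommutativeRing R

  pow : Carrier → ℕ → Carrier
  pow x zero = 1#
  pow x (suc e) = x * pow x e

  natR : ℕ → Carrier
  natR zero = 0#
  natR (suc m) = 1# + natR m

  HasCard : ℕ → Set (c ⊔ ℓ)
  HasCard N = Σ (Fin N → Carrier) λ e →
                (∀ i j → e i ≈ e j → i ≡ j) × (∀ x → ∃ λ i → e i ≈ x)

  -- R has characteristic p (for p prime this is the usual notion: p·1 = 0)
  HasChar : ℕ → Set ℓ
  HasChar p = natR p ≈ 0#

  IsPrimitive : Carrier → Set (c ⊔ ℓ)
  IsPrimitive ζ = ¬ (ζ ≈ 0#) × (∀ x → ¬ (x ≈ 0#) → ∃ λ j → pow ζ j ≈ x)

  sumL : List Carrier → Carrier
  sumL = foldr _+_ 0#

-- all lists [i₁, …, i_w] with 0 ≤ i₁ < ⋯ < i_w ≤ n-1 (as increasing lists)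
-- combos n w  : choose w elements from {0,…,n-1}
combos : ℕ → ℕ → List (List ℕ)
combos n zero = [] ∷ []
combos zero (suc w) = []
combos (suc n) (suc w) = combos n (suc w) ++ map (λ S → S ++ (n ∷ [])) (combos n w)

expo : ℕ → List ℕ → ℕ
expo q S = foldr (λ i acc → q ℕ.^ i ℕ.+ acc) 0 S

range : ℕ → List ℕ
range zero = []
range (suc m) = range m ++ (m ∷ [])

module _ {c ℓ : Level} (R : CommutativeRing c ℓ) where
  open CommutativeRing R

  σ : (q n w : ℕ) → Carrier → Carrier
  σ q n w x = sumL R (map (λ S → pow R x (expo q S)) (combos n w))

  -- δ_w(j) for a canonical representative j ∈ {0,…,q^n-2}:
  -- true iff j ∈ Ω(w), i.e. j = q^{i₁}+⋯+q^{i_w} for some 0≤i₁<⋯<i_w≤n-1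
  -- (for w = 0 this gives Ω(0) = {0}).
  δ : (q n w : ℕ) → ℕ → Bool
  δ q n w j = any (λ S → ⌊ j ℕ.≟ expo q S ⌋) (combos n w)

  -- image in R of an element of F_p that is 0 or 1 (values of δ_w)
  ind : Bool → Carrier
  ind true = 1#
  ind false = 0#

  DFTδ : (q n w : ℕ) → Carrier → ℕ → Carrier
  DFTδ q n w ζ k = sumL R (map (λ j → ind (δ q n w j) * pow R ζ (k ℕ.* j)) (range (q ℕ.^ n ℕ.∸ 1)))

{-# OPTIONS --safe #-}
module Submission where

-- The exponents q^{i₁} + ⋯ + q^{i_w} of the monomials of σ_w are pairwise
-- distinct: among subsets of {0, …, n}, those containing n give exponents at
-- least q^n, all others exponents below q^n.  They also lie in {0, …, q^n − 2}:
-- an exponent using w of the n indices is at most (1 + q + ⋯ + q^{n−1}) − (n − w),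
-- and that sum is (q^n − 1)/(q − 1), which is at most q^n − 2 when q ≥ 3; for
-- q = 2 the bound needs w < n.  Hence σ_w(ζ^k) is the sum of ζ^{kj} over the
-- j ∈ Ω(w), each counted once, which is the sum defining the DFT of δ_w.

open import Defs
open import Level using (Level)
open import Data.Nat as ℕ using (ℕ; zero; suc; _≤_; _<_; _^_; _∸_; _≟_; nonTrivial⇒n>1)
import Data.Nat.Properties as ℕ
open import Data.Nat.Primality using (Prime; prime; prime⇒nonZero)
open import Data.Bool using (Bool; true; false)
open import Data.Bool.ListAction using (any; or)
open import Data.List using (List; []; _∷_; map; _++_)
open import Data.List.Properties using (map-++; map-∘; map-cong)
open import Data.List.Relation.Unary.All as All using (All; []; _∷_)
import Data.List.Relation.Unary.All.Properties as All
open import Data.List.Relation.Unary.AllPairs using ([]; _∷_)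
open import Data.List.Relation.Unary.Unique.Propositional using (Unique)
open import Relation.Binary.PropositionalEquality as ≡ using (_≡_; _≢_)
open import Relation.Nullary.Decidable using (⌊_⌋; yes; no; isYes≗does; dec-true; dec-false)
open import Data.Sum using (_⊎_; inj₁; inj₂)
open import Algebra.Bundles using (CommutativeRing)

module Exponents where

  open import Data.Nat
  open import Data.Nat.Properties
  open import Data.Nat.Tactic.RingSolver using (solve-∀)
  import Data.List.Relation.Unary.Unique.Propositional.Properties as Unique
  open import Data.List.Membership.Propositional.Properties using (∈-map⁻)
  open import Data.List.Relation.Binary.Disjoint.Propositional using (Disjoint)
  open import Data.Product using (_,_)
  open import Relation.Binary.PropositionalEquality using (refl; sym; trans; cong; subst; module ≡-Reasoning)

  exponents : ℕ → ℕ → ℕ → List ℕ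
  exponents q n w = map (expo q) (combos n w)

  expo-++-singleton : ∀ q i S → expo q (S ++ i ∷ []) ≡ expo q S + q ^ i
  expo-++-singleton q i [] = +-comm (q ^ i) 0
  expo-++-singleton q i (j ∷ S) =
    trans (cong (q ^ j +_) (expo-++-singleton q i S)) (sym (+-assoc (q ^ j) _ _))

  exponents-suc : ∀ q n w →
    exponents q (suc n) (suc w) ≡ exponents q n (suc w) ++ map (_+ q ^ n) (exponents q n w)
  exponents-suc q n w = begin
    exponents q (suc n) (suc w)
      ≡⟨ map-++ (expo q) (combos n (suc w)) _ ⟩
    exponents q n (suc w) ++ map (expo q) (map (_++ n ∷ []) (combos n w))
      ≡⟨ cong (exponents q n (suc w) ++_) (sym (map-∘ (combos n w))) ⟩
    exponents q n (suc w) ++ map (λ S → expo q (S ++ n ∷ [])) (combos n w)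
      ≡⟨ cong (exponents q n (suc w) ++_) (map-cong (expo-++-singleton q n) (combos n w)) ⟩
    exponents q n (suc w) ++ map (λ S → expo q S + q ^ n) (combos n w)
      ≡⟨ cong (exponents q n (suc w) ++_) (map-∘ (combos n w)) ⟩
    exponents q n (suc w) ++ map (_+ q ^ n) (exponents q n w) ∎
    where open ≡-Reasoning

  repunit : ℕ → ℕ → ℕ
  repunit q zero = 0
  repunit q (suc n) = repunit q n + q ^ n

  1+d*repunit≡[1+d]^n : ∀ d n → 1 + d * repunit (1 + d) n ≡ (1 + d) ^ n
  1+d*repunit≡[1+d]^n d zero = cong suc (*-zeroʳ d)
  1+d*repunit≡[1+d]^n d (suc n) = begin
    1 + d * (repunit q n + q ^ n)     ≡⟨ cong suc (*-distribˡ-+ d (repunit q n) (q ^ n)) ⟩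
    1 + (d * repunit q n + d * q ^ n) ≡⟨ cong (_+ d * q ^ n) (1+d*repunit≡[1+d]^n d n) ⟩
    q ^ n + d * q ^ n                 ∎
    where
    q = 1 + d
    open ≡-Reasoning

  module _ (q : ℕ) .{{_ : NonZero q}} where

    n≤repunit : ∀ n → n ≤ repunit q n
    n≤repunit zero = z≤n
    n≤repunit (suc n) = subst (_≤ repunit q n + q ^ n) (+-comm n 1) (+-mono-≤ (n≤repunit n) (m^n>0 q n))

    exponent+n≤repunit+w : ∀ n w → All (λ e → e + n ≤ repunit q n + w) (exponents q n w)
    exponent+n≤repunit+w n zero = subst (n ≤_) (sym (+-identityʳ _)) (n≤repunit n) ∷ []
    exponent+n≤repunit+w zero (suc w) = []
    exponent+n≤repunit+w (suc n) (suc w) rewrite exponents-suc q n w =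
      All.++⁺ (All.map without-top (exponent+n≤repunit+w n (suc w)))
              (All.map⁺ (All.map with-top (exponent+n≤repunit+w n w)))
      where
      without-top : ∀ {e} → e + n ≤ repunit q n + suc w → e + suc n ≤ repunit q n + q ^ n + suc w
      without-top {e} h = begin
        e + suc n                      ≡⟨ +-suc e n ⟩
        1 + (e + n)                    ≤⟨ +-mono-≤ (m^n>0 q n) h ⟩
        q ^ n + (repunit q n + suc w)  ≡⟨ swap (q ^ n) (repunit q n) w ⟩
        repunit q n + q ^ n + suc w    ∎
        where
        open ≤-Reasoning
        swap : ∀ a b c → a + (b + suc c) ≡ b + a + suc c
        swap = solve-∀
      with-top : ∀ {e} → e + n ≤ repunit q n + w → e + q ^ n + suc n ≤ repunit q n + q ^ n + suc w
      with-top {e} h = begin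
        e + q ^ n + suc n              ≡⟨ shift e (q ^ n) n ⟩
        q ^ n + suc (e + n)            ≤⟨ +-monoʳ-≤ (q ^ n) (s≤s h) ⟩
        q ^ n + suc (repunit q n + w)  ≡⟨ shift (repunit q n) (q ^ n) w ⟨
        repunit q n + q ^ n + suc w    ∎
        where
        open ≤-Reasoning
        shift : ∀ a b c → a + b + suc c ≡ b + suc (a + c)
        shift = solve-∀

  1+repunit≤ : ∀ {q} → 2 ≤ q → ∀ n → 1 + repunit q n ≤ q ^ n
  1+repunit≤ {suc d} (s≤s 1≤d) n =
    subst (1 + repunit (suc d) n ≤_) (1+d*repunit≡[1+d]^n d n)
      (s≤s (m≤n*m (repunit (suc d) n) d {{>-nonZero 1≤d}}))

  2+repunit≤ : ∀ {q} → 3 ≤ q → ∀ {n} → 1 ≤ n → 2 + repunit q n ≤ q ^ n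
  2+repunit≤ {suc d} (s≤s 2≤d) {n} 1≤n = begin
    2 + R            ≤⟨ s≤s (+-monoˡ-≤ R (≤-trans 1≤n (n≤repunit (suc d) n))) ⟩
    1 + (R + R)      ≡⟨ cong (λ x → 1 + (R + x)) (sym (+-identityʳ R)) ⟩
    1 + 2 * R        ≤⟨ s≤s (*-monoˡ-≤ R 2≤d) ⟩
    1 + d * R        ≡⟨ 1+d*repunit≡[1+d]^n d n ⟩
    suc d ^ n        ∎
    where
    R = repunit (suc d) n
    open ≤-Reasoning

  module _ (q : ℕ) (2≤q : 2 ≤ q) where

    private instance
      q≢0 : NonZero q
      q≢0 = >-nonZero (≤-trans (s≤s z≤n) 2≤q)

    exponents<q^n : ∀ n w → All (_< q ^ n) (exponents q n w)
    exponents<q^n n zero = m^n>0 q n ∷ []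
    exponents<q^n zero (suc w) = []
    exponents<q^n (suc n) (suc w) rewrite exponents-suc q n w =
      All.++⁺ (All.map (λ e< → <-≤-trans e< (m≤n*m (q ^ n) q)) (exponents<q^n n (suc w)))
              (All.map⁺ (All.map +top-< (exponents<q^n n w)))
      where
      +top-< : ∀ {e} → e < q ^ n → e + q ^ n < q * q ^ n
      +top-< e< = <-≤-trans (+-monoˡ-< (q ^ n) e<)
        (≤-trans (≤-reflexive (cong (q ^ n +_) (sym (+-identityʳ _)))) (*-monoˡ-≤ (q ^ n) 2≤q))

    exponents-unique : ∀ n w → Unique (exponents q n w)
    exponents-unique n zero = [] ∷ []
    exponents-unique zero (suc w) = []
    exponents-unique (suc n) (suc w) rewrite exponents-suc q n w =
      Unique.++⁺ (exponents-unique n (suc w))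
                 (Unique.map⁺ (λ {x} {y} → +-cancelʳ-≡ (q ^ n) x y) (exponents-unique n w))
                 disjoint
      where
      disjoint : Disjoint (exponents q n (suc w)) (map (_+ q ^ n) (exponents q n w))
      disjoint (v∈low , v∈high) with ∈-map⁻ (_+ q ^ n) v∈high
      ... | e , _ , refl = <⇒≱ (All.lookup (exponents<q^n n (suc w)) v∈low) (m≤n+m (q ^ n) e)

    exponents<q^n∸1 : ∀ {n w} → 1 ≤ n → w ≤ n → (q ≡ 2 → w ≢ n) → All (_< q ^ n ∸ 1) (exponents q n w)
    exponents<q^n∸1 {n} {w} 1≤n w≤n q≡2⇒w≢n = All.map (λ {e} h → m+n≤o⇒m≤o∸n (suc e)
      (subst (_≤ q ^ n) (+-comm 1 (suc e)) (2+e≤q^n h))) (exponent+n≤repunit+w q n w)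
      where
      R = repunit q n
      2+e≤q^n : ∀ {e} → e + n ≤ R + w → 2 + e ≤ q ^ n
      2+e≤q^n {e} h with m≤n⇒m<n∨m≡n 2≤q
      ... | inj₁ 3≤q = ≤-trans (s≤s (s≤s e≤R)) (2+repunit≤ 3≤q 1≤n)
        where
        e≤R : e ≤ R
        e≤R = +-cancelʳ-≤ n e R (≤-trans h (+-monoʳ-≤ R w≤n))
      ... | inj₂ 2≡q = ≤-trans (s≤s e<R) (1+repunit≤ 2≤q n)
        where
        e<R : e < R
        e<R = +-cancelʳ-≤ n (suc e) R (≤-<-trans h (+-monoʳ-< R (≤∧≢⇒< w≤n (q≡2⇒w≢n (sym 2≡q)))))

open Exponents

_∈ᵇ_ : ℕ → List ℕ → Bool
j ∈ᵇ V = any (λ e → ⌊ j ≟ e ⌋) V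

⌊≟⌋-≢ : ∀ {j x} → j ≢ x → ⌊ j ≟ x ⌋ ≡ false
⌊≟⌋-≢ {j} {x} j≢x = ≡.trans (isYes≗does (j ≟ x)) (dec-false (j ≟ x) j≢x)

⌊≟⌋-refl : ∀ x → ⌊ x ≟ x ⌋ ≡ true
⌊≟⌋-refl x = ≡.trans (isYes≗does (x ≟ x)) (dec-true (x ≟ x) ≡.refl)

module _ {c ℓ : Level} (F : CommutativeRing c ℓ) where

  open CommutativeRing F
  open import Relation.Binary.Reasoning.Setoid setoid
  open import Algebra.Properties.Semiring.Exp semiring using (^-assocʳ)
    renaming (_^_ to _^ᴿ_)
  open import Algebra.Properties.CommutativeSemigroup +-commutativeSemigroup using (interchange)

  pow≡^ : ∀ x e → pow F x e ≡ x ^ᴿ e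
  pow≡^ x zero = ≡.refl
  pow≡^ x (suc e) = ≡.cong (x *_) (pow≡^ x e)

  pow-pow : ∀ x k e → pow F (pow F x k) e ≈ pow F x (k ℕ.* e)
  pow-pow x k e = begin
    pow F (pow F x k) e  ≡⟨ pow≡^ (pow F x k) e ⟩
    pow F x k ^ᴿ e       ≡⟨ ≡.cong (_^ᴿ e) (pow≡^ x k) ⟩
    (x ^ᴿ k) ^ᴿ e        ≈⟨ ^-assocʳ x k e ⟩
    x ^ᴿ (k ℕ.* e)        ≡⟨ pow≡^ x (k ℕ.* e) ⟨
    pow F x (k ℕ.* e)     ∎

  sumL-++ : ∀ xs ys → sumL F (xs ++ ys) ≈ sumL F xs + sumL F ys
  sumL-++ [] ys = sym (+-identityˡ _)
  sumL-++ (x ∷ xs) ys = trans (+-congˡ (sumL-++ xs ys)) (sym (+-assoc _ _ _))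

  module _ {A : Set} where

    sumL-map-cong : ∀ {f g : A → Carrier} xs → (∀ a → f a ≈ g a) → sumL F (map f xs) ≈ sumL F (map g xs)
    sumL-map-cong [] f≈g = refl
    sumL-map-cong (x ∷ xs) f≈g = +-cong (f≈g x) (sumL-map-cong xs f≈g)

    sumL-map-+ : ∀ (f g : A → Carrier) xs →
      sumL F (map (λ a → f a + g a) xs) ≈ sumL F (map f xs) + sumL F (map g xs)
    sumL-map-+ f g [] = sym (+-identityˡ 0#)
    sumL-map-+ f g (x ∷ xs) = trans (+-congˡ (sumL-map-+ f g xs)) (interchange _ _ _ _)

    sumL-map-0# : ∀ xs → sumL F (map (λ (_ : A) → 0#) xs) ≈ 0#
    sumL-map-0# [] = refl
    sumL-map-0# (x ∷ xs) = trans (+-congˡ (sumL-map-0# xs)) (+-identityʳ 0#)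

  sumRange : ℕ → (ℕ → Carrier) → Carrier
  sumRange N f = sumL F (map f (range N))

  sumRange-suc : ∀ N f → sumRange (suc N) f ≈ sumRange N f + f N
  sumRange-suc N f = begin
    sumL F (map f (range N ++ N ∷ []))    ≡⟨ ≡.cong (sumL F) (map-++ f (range N) _) ⟩
    sumL F (map f (range N) ++ f N ∷ [])  ≈⟨ sumL-++ (map f (range N)) _ ⟩
    sumRange N f + (f N + 0#)             ≈⟨ +-congˡ (+-identityʳ _) ⟩
    sumRange N f + f N                    ∎

  ind-≟-*-≢ : ∀ {j x} → j ≢ x → ∀ a → ind F ⌊ j ≟ x ⌋ * a ≈ 0#
  ind-≟-*-≢ {j} {x} j≢x a =
    trans (reflexive (≡.cong (λ b → ind F b * a) (⌊≟⌋-≢ j≢x))) (zeroˡ a)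

  sumRange-delta-≥ : ∀ {x} (f : ℕ → Carrier) N → N ≤ x → sumRange N (λ j → ind F ⌊ j ≟ x ⌋ * f j) ≈ 0#
  sumRange-delta-≥ f zero _ = refl
  sumRange-delta-≥ {x} f (suc N) N<x = begin
    sumRange (suc N) (λ j → ind F ⌊ j ≟ x ⌋ * f j)  ≈⟨ sumRange-suc N _ ⟩
    sumRange N (λ j → ind F ⌊ j ≟ x ⌋ * f j) + ind F ⌊ N ≟ x ⌋ * f N
                                                     ≈⟨ +-cong (sumRange-delta-≥ f N (ℕ.<⇒≤ N<x)) (ind-≟-*-≢ (ℕ.<⇒≢ N<x) (f N)) ⟩
    0# + 0#                                          ≈⟨ +-identityʳ 0# ⟩
    0#                                               ∎

  sumRange-delta : ∀ {x} (f : ℕ → Carrier) N → x < N → sumRange N (λ j → ind F ⌊ j ≟ x ⌋ * f j) ≈ f x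
  sumRange-delta {x} f (suc N) x<1+N = trans (sumRange-suc N _) (last-or-earlier (ℕ.m≤n⇒m<n∨m≡n (ℕ.s≤s⁻¹ x<1+N)))
    where
    last-or-earlier : x < N ⊎ x ≡ N → sumRange N (λ j → ind F ⌊ j ≟ x ⌋ * f j) + ind F ⌊ N ≟ x ⌋ * f N ≈ f x
    last-or-earlier (inj₁ x<N) =
      trans (+-cong (sumRange-delta f N x<N) (ind-≟-*-≢ (ℕ.>⇒≢ x<N) (f N))) (+-identityʳ (f x))
    last-or-earlier (inj₂ ≡.refl) =
      trans (+-cong (sumRange-delta-≥ f N ℕ.≤-refl) (reflexive (≡.cong (λ b → ind F b * f x) (⌊≟⌋-refl x))))
            (trans (+-identityˡ _) (*-identityˡ (f x)))

  ∈ᵇ-false : ∀ {j} V → All (j ≢_) V → j ∈ᵇ V ≡ false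
  ∈ᵇ-false [] [] = ≡.refl
  ∈ᵇ-false (e ∷ V) (j≢e ∷ j∉V) rewrite ⌊≟⌋-≢ j≢e = ∈ᵇ-false V j∉V

  ind-∈ᵇ-∷ : ∀ {x V} → All (x ≢_) V → ∀ j a →
    ind F (j ∈ᵇ (x ∷ V)) * a ≈ ind F ⌊ j ≟ x ⌋ * a + ind F (j ∈ᵇ V) * a
  ind-∈ᵇ-∷ {x} {V} x∉V j a with j ≟ x
  ... | yes ≡.refl rewrite ∈ᵇ-false V x∉V = sym (trans (+-congˡ (zeroˡ a)) (+-identityʳ _))
  ... | no _ = sym (trans (+-congʳ (zeroˡ a)) (+-identityˡ _))

  sumRange-indicator : ∀ N {V} → Unique V → All (_< N) V → ∀ f →
    sumRange N (λ j → ind F (j ∈ᵇ V) * f j) ≈ sumL F (map f V)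
  sumRange-indicator N [] [] f =
    trans (sumL-map-cong (range N) (λ j → zeroˡ (f j))) (sumL-map-0# (range N))
  sumRange-indicator N {x ∷ V} (x∉V ∷ V-unique) (x<N ∷ V<N) f = begin
    sumRange N (λ j → ind F (j ∈ᵇ (x ∷ V)) * f j)
      ≈⟨ sumL-map-cong (range N) (λ j → ind-∈ᵇ-∷ x∉V j (f j)) ⟩
    sumRange N (λ j → ind F ⌊ j ≟ x ⌋ * f j + ind F (j ∈ᵇ V) * f j)
      ≈⟨ sumL-map-+ _ _ (range N) ⟩
    sumRange N (λ j → ind F ⌊ j ≟ x ⌋ * f j) + sumRange N (λ j → ind F (j ∈ᵇ V) * f j)
      ≈⟨ +-cong (sumRange-delta f N x<N) (sumRange-indicator N V-unique V<N f) ⟩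
    f x + sumL F (map f V) ∎

any-map : ∀ {A B : Set} (p : B → Bool) (f : A → B) xs → any p (map f xs) ≡ any (λ a → p (f a)) xs
any-map p f xs = ≡.cong or (≡.sym (map-∘ xs))

2≤p^m : ∀ {p} m → Prime p → 1 ≤ m → 2 ≤ p ^ m
2≤p^m {p} m p-prime@(prime _) 1≤m = ℕ.≤-trans (nonTrivial⇒n>1 p)
  (≡.subst (_≤ p ^ m) (ℕ.^-identityʳ p) (ℕ.^-monoʳ-≤ p {{prime⇒nonZero p-prime}} 1≤m))

lemma4p1 : {c ℓ : Level} (p q m n w : ℕ) → Prime p → 1 ≤ m → q ≡ p ^ m → 2 ≤ n → w ≤ n → (q ≡ 2 → w ≢ n) → (F : CommutativeRing c ℓ) → IsField F → HasCard F (q ^ n) → HasChar F p → (ζ : CommutativeRing.Carrier F) → IsPrimitive F ζ → (k : ℕ) → k < q ^ n ∸ 1 → CommutativeRing._≈_ F (σ F q n w (pow F ζ k)) (DFTδ F q n w ζ k)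
lemma4p1 p q m n w p-prime 1≤m ≡.refl 2≤n w≤n q≡2⇒w≢n F _ _ _ ζ _ k _ = begin
  σ F q n w (pow F ζ k)
    ≡⟨ ≡.cong (sumL F) (map-∘ (combos n w)) ⟩
  sumL F (map (pow F (pow F ζ k)) (exponents q n w))
    ≈⟨ sumL-map-cong F (exponents q n w) (pow-pow F ζ k) ⟩
  sumL F (map χ (exponents q n w))
    ≈⟨ sumRange-indicator F N (exponents-unique q 2≤q n w) (exponents<q^n∸1 q 2≤q 1≤n w≤n q≡2⇒w≢n) χ ⟨
  sumRange F N (λ j → ind F (j ∈ᵇ exponents q n w) * χ j)
    ≈⟨ sumL-map-cong F (range N) (λ j → reflexive (≡.cong (λ b → ind F b * χ j) (any-map _ (expo q) (combos n w)))) ⟩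
  DFTδ F q n w ζ k ∎
  where
  open CommutativeRing F
  open import Relation.Binary.Reasoning.Setoid setoid
  N : ℕ
  N = q ^ n ∸ 1
  2≤q : 2 ≤ q
  2≤q = 2≤p^m m p-prime 1≤m
  1≤n : 1 ≤ n
  1≤n = ℕ.≤-trans (ℕ.s≤s ℕ.z≤n) 2≤n
  χ : ℕ → Carrier
  χ j = pow F ζ (k ℕ.* j)
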